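{- For any integer $k\ge2$ and every item sequence $I$, $NF_k(I)\le\left(3-\frac2k\right)\cdot OPT_k(I)+1$.
   Context: $k$-cardinality constrained bin packing: an input is $I=(a_1,\dots,a_n)\in(0,1]^n$; a feasible assignment is a map $f:\{1,\dots,n\}\to\mathbb{N}$ such that every bin has total size at most $1$ and contains at most $k$ items. $OPT_k(I)$ is the minimum number of non-empty bins of a feasible assignment. Algorithm $NF_k$: process the items in the given order (no sorting) with a single current bin: pack the next item into the current bin if it fits (load stays $\le1$) and the bin contains fewer than $k$ items; otherwise close the current bin, open a new bin, and pack the item there. $NF_k(I)$ is the number of non-empty bins produced.
   Formalization: The item sizes $a_1,\dots,a_n$ are rational. -}

module Defs where

open import Data.Bool using (Bool; true; false; _∧_)
open import Data.Nat as ℕ using (ℕ; zero; suc; _<ᵇ_)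
import Data.Nat.Properties as ℕP
open import Data.Integer using (+_)
open import Data.Rational as ℚ using (ℚ; 0ℚ; 1ℚ; _+_; _≤ᵇ_)
open import Data.Fin using (Fin)
open import Data.List using (List; []; _∷_; length; lookup; filter; map; foldr; allFin; deduplicate)
open import Data.List.Relation.Unary.All using (All)
open import Data.Product using (_×_; ∃)

toℚ : ℕ → ℚ
toℚ n = + n ℚ./ 1

sumℚ : List ℚ → ℚ
sumℚ = foldr _+_ 0ℚ

ValidInput : List ℚ → Set
ValidInput I = All (λ a → (0ℚ ℚ.< a) × (a ℚ.≤ 1ℚ)) I

-- nfGo k load cnt rest : number of bins used, given that the current
-- (open, non-empty) bin has total size `load` and contains `cnt` items,
-- and `rest` are the items still to be packed.
nfGo : ℕ → ℚ → ℕ → List ℚ → ℕ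
nfGo k load cnt [] = 1
nfGo k load cnt (a ∷ as) with ((load + a) ≤ᵇ 1ℚ) ∧ (cnt <ᵇ k)
... | true  = nfGo k (load + a) (suc cnt) as
... | false = suc (nfGo k a 1 as)

NF : ℕ → List ℚ → ℕ
NF k []       = 0
NF k (a ∷ as) = nfGo k a 1 as

Assignment : List ℚ → Set
Assignment I = Fin (length I) → ℕ

itemsIn : (I : List ℚ) → Assignment I → ℕ → List (Fin (length I))
itemsIn I f b = filter (λ i → f i ℕ.≟ b) (allFin (length I))

load : (I : List ℚ) → Assignment I → ℕ → ℚ
load I f b = sumℚ (map (lookup I) (itemsIn I f b))

count : (I : List ℚ) → Assignment I → ℕ → ℕ
count I f b = length (itemsIn I f b)

Feasible : ℕ → (I : List ℚ) → Assignment I → Set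
Feasible k I f = ∀ (b : ℕ) → (load I f b ℚ.≤ 1ℚ) × (count I f b ℕ.≤ k)

usedBins : (I : List ℚ) → Assignment I → ℕ
usedBins I f = length (deduplicate ℕ._≟_ (map f (allFin (length I))))

IsOPT : ℕ → (I : List ℚ) → ℕ → Set
IsOPT k I m =
  (∃ λ (f : Assignment I) → Feasible k I f × (usedBins I f ≡ m))
  × (∀ (f : Assignment I) → Feasible k I f → m ℕ.≤ usedBins I f)
  where open import Relation.Binary.PropositionalEquality using (_≡_)

{-# OPTIONS --safe #-}
-- Proof idea, with k = j + 1.  Every item pays 1 + 2j·(its size) into a credit account, and j
-- more is paid up front.  Next Fit closes a bin only when it holds k items, which pay its k,
-- or when the next item overflows it: then the bin's items pay at least 1 and j·(bin load +
-- overflowing size) > j pays the rest, so each size is charged once for its own bin and once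
-- for the bin before it.  Hence k·NF ≤ n + j(2S + 1) for n items of total size S, while any
-- feasible assignment into m bins has n ≤ k·m and S ≤ m; so k·NF ≤ (3k − 2)·OPT + k − 1.
module Submission where

open import Defs
open import Data.Nat using (ℕ; NonZero; _≤_)
open import Data.Integer using (+_)
open import Data.Rational using (ℚ; _/_; _+_; _*_; _-_; 1ℚ)
import Data.Rational as ℚ
open import Data.List using (List)

open import Data.Bool using (true; false; T; if_then_else_)
open import Data.Fin using (Fin)
open import Data.List using ([]; _∷_; length; map; filter; allFin; deduplicate; lookup)
import Data.List.Properties as List
open import Data.List.Membership.Propositional using (_∈_)
open import Data.List.Membership.Propositional.Properties using (∈-allFin; ∈-map⁺; ∈-deduplicate⁺; ∈-lookup)
open import Data.List.Relation.Unary.All as All using (All; []; _∷_)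
open import Data.List.Relation.Unary.Any using (here; there)
open import Relation.Nullary.Decidable using (dec⇒maybe)
open import Data.Nat as ℕ using (suc; _<ᵇ_; _≡ᵇ_)
import Data.Nat.Properties as ℕ
import Data.Integer as ℤ
import Data.Integer.Properties as ℤ
open import Data.Rational using (0ℚ; toℚᵘ)
import Data.Rational.Properties as ℚ
open import Data.Rational.Unnormalised as ℚᵘ using (mkℚᵘ; *≡*) renaming (_≃_ to _≃ᵘ_)
import Data.Rational.Unnormalised.Properties as ℚᵘ
open import Data.Product using (_,_; proj₁; proj₂)
open import Data.Sum using (_⊎_; inj₁; inj₂)
open import Function using (_∘_)
open import Level using (0ℓ)
open import Relation.Binary.PropositionalEquality
import Tactic.RingSolver.Core.AlmostCommutativeRing as ACR
open import Tactic.RingSolver using (solve-∀)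

ℚ-ring : ACR.AlmostCommutativeRing 0ℓ 0ℓ
ℚ-ring = ACR.fromCommutativeRing ℚ.+-*-commutativeRing (λ x → dec⇒maybe (0ℚ ℚ.≟ x))

-- toℚ n is definitionally fromℚᵘ (mkℚᵘ (+ n) 0), so identities about toℚ can be checked in
-- ℚᵘ, where no gcd normalisation gets in the way.
toℚᵘ-toℚ : ∀ n → toℚᵘ (toℚ n) ≃ᵘ mkℚᵘ (+ n) 0
toℚᵘ-toℚ n = ℚ.toℚᵘ-fromℚᵘ (mkℚᵘ (+ n) 0)

toℚ-+ : ∀ m n → toℚ (m ℕ.+ n) ≡ toℚ m + toℚ n
toℚ-+ m n = ℚ.toℚᵘ-injective (begin-equality
  toℚᵘ (toℚ (m ℕ.+ n))                      ≃⟨ toℚᵘ-toℚ (m ℕ.+ n) ⟩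
  mkℚᵘ (+ (m ℕ.+ n)) 0                       ≃⟨ *≡* (cong (ℤ._* + 1) (trans (ℤ.pos-+ m n)
                                                   (sym (cong₂ ℤ._+_ (ℤ.*-identityʳ (+ m)) (ℤ.*-identityʳ (+ n)))))) ⟩
  mkℚᵘ (+ m) 0 ℚᵘ.+ mkℚᵘ (+ n) 0             ≃⟨ ℚᵘ.+-cong (toℚᵘ-toℚ m) (toℚᵘ-toℚ n) ⟨
  toℚᵘ (toℚ m) ℚᵘ.+ toℚᵘ (toℚ n)             ≃⟨ ℚ.toℚᵘ-homo-+ (toℚ m) (toℚ n) ⟨
  toℚᵘ (toℚ m + toℚ n)                       ∎)
  where open ℚᵘ.≤-Reasoning

toℚ-suc : ∀ n → toℚ (suc n) ≡ 1ℚ + toℚ n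
toℚ-suc = toℚ-+ 1

toℚ-*-/ : ∀ m n → toℚ (suc n) * (+ m / suc n) ≡ toℚ m
toℚ-*-/ m n = ℚ.toℚᵘ-injective (begin-equality
  toℚᵘ (toℚ (suc n) * (+ m / suc n))         ≃⟨ ℚ.toℚᵘ-homo-* (toℚ (suc n)) (+ m / suc n) ⟩
  toℚᵘ (toℚ (suc n)) ℚᵘ.* toℚᵘ (+ m / suc n) ≃⟨ ℚᵘ.*-cong (toℚᵘ-toℚ (suc n)) (ℚ.toℚᵘ-fromℚᵘ (mkℚᵘ (+ m) n)) ⟩
  mkℚᵘ (+ suc n) 0 ℚᵘ.* mkℚᵘ (+ m) n         ≃⟨ *≡* (trans (ℤ.*-identityʳ _) (trans (ℤ.*-comm (+ suc n) (+ m))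
                                                   (cong (λ d → + m ℤ.* + d) (sym (ℕ.*-identityˡ (suc n)))))) ⟩
  mkℚᵘ (+ m) 0                               ≃⟨ toℚᵘ-toℚ m ⟨
  toℚᵘ (toℚ m)                               ∎)
  where open ℚᵘ.≤-Reasoning

0≤toℚ : ∀ n → 0ℚ ℚ.≤ toℚ n
0≤toℚ n = ℚ.nonNegative⁻¹ (toℚ n) {{ℚ.normalize-nonNeg n 1}}

p≤p+q : ∀ {p q} → 0ℚ ℚ.≤ q → p ℚ.≤ p + q
p≤p+q {p} {q} 0≤q = begin
  p       ≡⟨ ℚ.+-identityʳ p ⟨
  p + 0ℚ  ≤⟨ ℚ.+-monoʳ-≤ p 0≤q ⟩
  p + q   ∎
  where open ℚ.≤-Reasoning

q≤p+q : ∀ {p q} → 0ℚ ℚ.≤ p → q ℚ.≤ p + q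
q≤p+q {p} {q} 0≤p = begin
  q       ≡⟨ ℚ.+-identityˡ q ⟨
  0ℚ + q  ≤⟨ ℚ.+-monoˡ-≤ q 0≤p ⟩
  p + q   ∎
  where open ℚ.≤-Reasoning

p≤q⇒0≤q-p : ∀ {p q} → p ℚ.≤ q → 0ℚ ℚ.≤ q - p
p≤q⇒0≤q-p {p} {q} p≤q = begin
  0ℚ      ≡⟨ ℚ.+-inverseʳ p ⟨
  p - p   ≤⟨ ℚ.+-monoˡ-≤ (ℚ.- p) p≤q ⟩
  q - p   ∎
  where open ℚ.≤-Reasoning

0≤p*q : ∀ {p q} → 0ℚ ℚ.≤ p → 0ℚ ℚ.≤ q → 0ℚ ℚ.≤ p * q
0≤p*q {p} {q} 0≤p 0≤q =
  ℚ.nonNegative⁻¹ (p * q) {{ℚ.nonNeg*nonNeg⇒nonNeg p {{ℚ.nonNegative 0≤p}} q {{ℚ.nonNegative 0≤q}}}}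

toℚ-mono : ∀ {m n} → m ≤ n → toℚ m ℚ.≤ toℚ n
toℚ-mono {m} {n} m≤n = begin
  toℚ m                  ≤⟨ p≤p+q (0≤toℚ (n ℕ.∸ m)) ⟩
  toℚ m + toℚ (n ℕ.∸ m)  ≡⟨ toℚ-+ m (n ℕ.∸ m) ⟨
  toℚ (m ℕ.+ (n ℕ.∸ m))  ≡⟨ cong toℚ (ℕ.m+[n∸m]≡n m≤n) ⟩
  toℚ n                  ∎
  where open ℚ.≤-Reasoning

<ᵇ≡false⇒≥ : ∀ {m n} → (m <ᵇ n) ≡ false → n ≤ m
<ᵇ≡false⇒≥ m≮ᵇn = ℕ.≮⇒≥ (λ m<n → subst T m≮ᵇn (ℕ.<⇒<ᵇ m<n))

≤ᵇ≡false⇒> : ∀ {p q} → (p ℚ.≤ᵇ q) ≡ false → q ℚ.< p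
≤ᵇ≡false⇒> p≰ᵇq = ℚ.≰⇒> (λ p≤q → subst T p≰ᵇq (ℚ.≤⇒≤ᵇ p≤q))

sumℚ-map-nonNeg : ∀ {A : Set} (h : A → ℚ) → (∀ x → 0ℚ ℚ.≤ h x) → ∀ xs → 0ℚ ℚ.≤ sumℚ (map h xs)
sumℚ-map-nonNeg h 0≤h []       = ℚ.≤-refl
sumℚ-map-nonNeg h 0≤h (x ∷ xs) = ℚ.+-mono-≤ (0≤h x) (sumℚ-map-nonNeg h 0≤h xs)

sumℚ-map-+ : ∀ {A : Set} (g h : A → ℚ) xs →
             sumℚ (map (λ x → g x + h x) xs) ≡ sumℚ (map g xs) + sumℚ (map h xs)
sumℚ-map-+ g h []       = refl
sumℚ-map-+ g h (x ∷ xs) rewrite sumℚ-map-+ g h xs =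
  interchange (g x) (h x) (sumℚ (map g xs)) (sumℚ (map h xs))
  where
  interchange : ∀ a b c d → (a + b) + (c + d) ≡ (a + c) + (b + d)
  interchange = solve-∀ ℚ-ring

sumℚ-map-≤ : ∀ {A : Set} (h : A → ℚ) c → (∀ x → h x ℚ.≤ c) → ∀ xs →
             sumℚ (map h xs) ℚ.≤ c * toℚ (length xs)
sumℚ-map-≤ h c h≤c []       = ℚ.≤-reflexive (sym (ℚ.*-zeroʳ c))
sumℚ-map-≤ h c h≤c (x ∷ xs) = begin
  h x + sumℚ (map h xs)          ≤⟨ ℚ.+-mono-≤ (h≤c x) (sumℚ-map-≤ h c h≤c xs) ⟩
  c + c * toℚ (length xs)        ≡⟨ distrib c (toℚ (length xs)) ⟩
  c * (1ℚ + toℚ (length xs))     ≡⟨ cong (c *_) (toℚ-suc (length xs)) ⟨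
  c * toℚ (length (x ∷ xs))      ∎
  where
  open ℚ.≤-Reasoning
  distrib : ∀ c n → c + c * n ≡ c * (1ℚ + n)
  distrib = solve-∀ ℚ-ring

sumℚ-map-1 : ∀ {A : Set} (xs : List A) → sumℚ (map (λ _ → 1ℚ) xs) ≡ toℚ (length xs)
sumℚ-map-1 []       = refl
sumℚ-map-1 (x ∷ xs) = trans (cong (λ s → 1ℚ + s) (sumℚ-map-1 xs)) (sym (toℚ-suc (length xs)))

≤-sumℚ-map : ∀ {A : Set} (h : A → ℚ) → (∀ x → 0ℚ ℚ.≤ h x) → ∀ {v D} → v ∈ D → h v ℚ.≤ sumℚ (map h D)
≤-sumℚ-map h 0≤h {D = v ∷ D} (here refl) = p≤p+q (sumℚ-map-nonNeg h 0≤h D)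
≤-sumℚ-map h 0≤h {D = b ∷ D} (there v∈D) = ℚ.≤-trans (≤-sumℚ-map h 0≤h v∈D) (q≤p+q (0≤h b))

sumℚ-≤-sum-of-fibres : ∀ {A : Set} (f : A → ℕ) (g : A → ℚ) → (∀ x → 0ℚ ℚ.≤ g x) →
                       ∀ {D} → (∀ x → f x ∈ D) → ∀ xs →
                       sumℚ (map g xs) ℚ.≤ sumℚ (map (λ b → sumℚ (map g (filter (λ x → f x ℕ.≟ b) xs))) D)
sumℚ-≤-sum-of-fibres f g 0≤g {D} f∈D []       = sumℚ-map-nonNeg _ (λ _ → ℚ.≤-refl) D
sumℚ-≤-sum-of-fibres f g 0≤g {D} f∈D (x ∷ xs) = begin
  g x + sumℚ (map g xs)                           ≤⟨ ℚ.+-mono-≤ x-in-its-fibre (sumℚ-≤-sum-of-fibres f g 0≤g f∈D xs) ⟩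
  sumℚ (map x-at D) + sumℚ (map (fibre xs) D)     ≡⟨ sumℚ-map-+ x-at (fibre xs) D ⟨
  sumℚ (map (λ b → x-at b + fibre xs b) D)        ≡⟨ cong sumℚ (List.map-cong add-x D) ⟩
  sumℚ (map (fibre (x ∷ xs)) D)                   ∎
  where
  open ℚ.≤-Reasoning
  fibre : List _ → ℕ → ℚ
  fibre ys b = sumℚ (map g (filter (λ y → f y ℕ.≟ b) ys))

  x-at : ℕ → ℚ
  x-at b = if f x ≡ᵇ b then g x else 0ℚ

  x-at-nonNeg : ∀ b → 0ℚ ℚ.≤ x-at b
  x-at-nonNeg b with f x ≡ᵇ b
  ... | true  = 0≤g x
  ... | false = ℚ.≤-refl

  x-at-own-label : x-at (f x) ≡ g x
  x-at-own-label with f x ≡ᵇ f x | ℕ.≡⇒≡ᵇ (f x) (f x) refl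
  ... | true | _ = refl

  x-in-its-fibre : g x ℚ.≤ sumℚ (map x-at D)
  x-in-its-fibre = subst (ℚ._≤ sumℚ (map x-at D)) x-at-own-label (≤-sumℚ-map x-at x-at-nonNeg (f∈D x))

  add-x : ∀ b → x-at b + fibre xs b ≡ fibre (x ∷ xs) b
  add-x b with f x ≡ᵇ b
  ... | true  = refl
  ... | false = ℚ.+-identityˡ (fibre xs b)

usedLabels : (I : List ℚ) → Assignment I → List ℕ
usedLabels I f = deduplicate ℕ._≟_ (map f (allFin (length I)))

label-∈-usedLabels : ∀ I (f : Assignment I) i → f i ∈ usedLabels I f
label-∈-usedLabels I f i = ∈-deduplicate⁺ ℕ._≟_ (∈-map⁺ f (∈-allFin i))

weight-≤-usedBins : ∀ I (f : Assignment I) (g : Fin (length I) → ℚ) c → (∀ i → 0ℚ ℚ.≤ g i) →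
                    (∀ b → sumℚ (map g (itemsIn I f b)) ℚ.≤ c) →
                    sumℚ (map g (allFin (length I))) ℚ.≤ c * toℚ (usedBins I f)
weight-≤-usedBins I f g c 0≤g bin-weight≤c = ℚ.≤-trans
  (sumℚ-≤-sum-of-fibres f g 0≤g (label-∈-usedLabels I f) (allFin (length I)))
  (sumℚ-map-≤ _ c bin-weight≤c (usedLabels I f))

sizes-nonNeg : ∀ {I} → ValidInput I → All (0ℚ ℚ.≤_) I
sizes-nonNeg = All.map (ℚ.<⇒≤ ∘ proj₁)

size-≤-usedBins : ∀ k I (f : Assignment I) → ValidInput I → Feasible k I f →
                  sumℚ I ℚ.≤ toℚ (usedBins I f)
size-≤-usedBins k I f valid feasible = begin
  sumℚ I                                 ≡⟨ cong sumℚ items-by-index ⟨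
  sumℚ (map (lookup I) (allFin (length I))) ≤⟨ weight-≤-usedBins I f (lookup I) 1ℚ item-nonNeg (proj₁ ∘ feasible) ⟩
  1ℚ * toℚ (usedBins I f)                ≡⟨ ℚ.*-identityˡ _ ⟩
  toℚ (usedBins I f)                     ∎
  where
  open ℚ.≤-Reasoning
  items-by-index : map (lookup I) (allFin (length I)) ≡ I
  items-by-index = trans (List.map-tabulate (λ i → i) (lookup I)) (List.tabulate-lookup I)
  item-nonNeg : ∀ i → 0ℚ ℚ.≤ lookup I i
  item-nonNeg i = All.lookup (sizes-nonNeg valid) (∈-lookup i)

length-≤-usedBins : ∀ k I (f : Assignment I) → Feasible k I f →
                    toℚ (length I) ℚ.≤ toℚ k * toℚ (usedBins I f)
length-≤-usedBins k I f feasible = begin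
  toℚ (length I)                                ≡⟨ cong toℚ (List.length-tabulate {n = length I} (λ i → i)) ⟨
  toℚ (length (allFin (length I)))              ≡⟨ sumℚ-map-1 (allFin (length I)) ⟨
  sumℚ (map (λ _ → 1ℚ) (allFin (length I)))     ≤⟨ weight-≤-usedBins I f (λ _ → 1ℚ) (toℚ k) (λ _ → 0≤toℚ 1) bin-count≤k ⟩
  toℚ k * toℚ (usedBins I f)                    ∎
  where
  open ℚ.≤-Reasoning
  bin-count≤k : ∀ b → sumℚ (map (λ _ → 1ℚ) (itemsIn I f b)) ℚ.≤ toℚ k
  bin-count≤k b = subst (ℚ._≤ toℚ k) (sym (sumℚ-map-1 (itemsIn I f b))) (toℚ-mono {count I f b} {k} (proj₂ (feasible b)))

-- The credit still held by Next Fit with k = j + 1 when its open bin has load L and c items and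
-- rest is yet to come: c + j·L for the open bin, 1 + 2j·a per pending item a, and j in reserve.
potential : ℕ → ℚ → ℕ → List ℚ → ℚ
potential j L c rest = toℚ c + toℚ (length rest) + toℚ j * (L + (sumℚ rest + sumℚ rest) + 1ℚ)

potential-[] : ∀ j L c → potential j L (suc c) [] ≡ toℚ (suc j) * toℚ 1 + (toℚ c + toℚ j * L)
potential-[] j L c rewrite toℚ-suc j | toℚ-suc c = identity (toℚ j) (toℚ c) L
  where
  identity : ∀ J C L → (1ℚ + C) + toℚ 0 + J * (L + (0ℚ + 0ℚ) + 1ℚ) ≡ (1ℚ + J) * toℚ 1 + (C + J * L)
  identity = solve-∀ ℚ-ring

potential-fit : ∀ j L c a as → potential j L c (a ∷ as) ≡ potential j (L + a) (suc c) as + toℚ j * a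
potential-fit j L c a as rewrite toℚ-suc c | toℚ-suc (length as) =
  identity (toℚ j) (toℚ c) (toℚ (length as)) L a (sumℚ as)
  where
  identity : ∀ J C N L a S → C + (1ℚ + N) + J * (L + ((a + S) + (a + S)) + 1ℚ)
                           ≡ (1ℚ + C) + N + J * ((L + a) + (S + S) + 1ℚ) + J * a
  identity = solve-∀ ℚ-ring

potential-close : ∀ j L c a as → potential j L (suc c) (a ∷ as)
                  ≡ (toℚ (suc j) + potential j a 1 as) + (toℚ c + toℚ j * (L + a) - toℚ j)
potential-close j L c a as rewrite toℚ-suc j | toℚ-suc c | toℚ-suc (length as) =
  identity (toℚ j) (toℚ c) (toℚ (length as)) L a (sumℚ as)
  where
  identity : ∀ J C N L a S → (1ℚ + C) + (1ℚ + N) + J * (L + ((a + S) + (a + S)) + 1ℚ)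
                           ≡ ((1ℚ + J) + (toℚ 1 + N + J * (a + (S + S) + 1ℚ))) + (C + J * (L + a) - J)
  identity = solve-∀ ℚ-ring

potential-start : ∀ j a as → toℚ (length (a ∷ as)) + toℚ j * (sumℚ (a ∷ as) + sumℚ (a ∷ as) + 1ℚ)
                  ≡ potential j a 1 as + toℚ j * a
potential-start j a as rewrite toℚ-suc (length as) = identity (toℚ j) (toℚ (length as)) a (sumℚ as)
  where
  identity : ∀ J N a S → (1ℚ + N) + J * ((a + S) + (a + S) + 1ℚ) ≡ toℚ 1 + N + J * (a + (S + S) + 1ℚ) + J * a
  identity = solve-∀ ℚ-ring

closing-slack : ∀ j c L a → 0ℚ ℚ.≤ L + a → j ≤ c ⊎ 1ℚ ℚ.< L + a → toℚ j ℚ.≤ toℚ c + toℚ j * (L + a)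
closing-slack j c L a 0≤L+a (inj₁ j≤c) =
  ℚ.≤-trans (toℚ-mono j≤c) (p≤p+q (0≤p*q (0≤toℚ j) 0≤L+a))
closing-slack j c L a 0≤L+a (inj₂ 1<L+a) = begin
  toℚ j                      ≡⟨ ℚ.*-identityʳ (toℚ j) ⟨
  toℚ j * 1ℚ                 ≤⟨ ℚ.*-monoˡ-≤-nonNeg (toℚ j) {{ℚ.normalize-nonNeg j 1}} (ℚ.<⇒≤ 1<L+a) ⟩
  toℚ j * (L + a)            ≤⟨ q≤p+q (0≤toℚ c) ⟩
  toℚ c + toℚ j * (L + a)    ∎
  where open ℚ.≤-Reasoning

new-bin-bound : ∀ j L c a as n → 0ℚ ℚ.≤ L + a → j ≤ c ⊎ 1ℚ ℚ.< L + a →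
                toℚ (suc j) * toℚ n ℚ.≤ potential j a 1 as →
                toℚ (suc j) * toℚ (suc n) ℚ.≤ potential j L (suc c) (a ∷ as)
new-bin-bound j L c a as n 0≤L+a closes bound = begin
  k * toℚ (suc n)                       ≡⟨ cong (k *_) (toℚ-suc n) ⟩
  k * (1ℚ + toℚ n)                      ≡⟨ distrib k (toℚ n) ⟩
  k + k * toℚ n                         ≤⟨ ℚ.+-monoʳ-≤ k bound ⟩
  k + potential j a 1 as                ≤⟨ p≤p+q (p≤q⇒0≤q-p (closing-slack j c L a 0≤L+a closes)) ⟩
  k + potential j a 1 as + (toℚ c + toℚ j * (L + a) - toℚ j) ≡⟨ potential-close j L c a as ⟨
  potential j L (suc c) (a ∷ as)        ∎
  where
  open ℚ.≤-Reasoning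
  k : ℚ
  k = toℚ (suc j)
  distrib : ∀ k n → k * (1ℚ + n) ≡ k + k * n
  distrib = solve-∀ ℚ-ring

nfGo-bound : ∀ j L c rest → 0ℚ ℚ.≤ L → All (0ℚ ℚ.≤_) rest →
             toℚ (suc j) * toℚ (nfGo (suc j) L (suc c) rest) ℚ.≤ potential j L (suc c) rest
nfGo-bound j L c [] 0≤L [] = begin
  toℚ (suc j) * toℚ 1                        ≤⟨ p≤p+q (ℚ.+-mono-≤ (0≤toℚ c) (0≤p*q (0≤toℚ j) 0≤L)) ⟩
  toℚ (suc j) * toℚ 1 + (toℚ c + toℚ j * L)  ≡⟨ potential-[] j L c ⟨
  potential j L (suc c) []                   ∎
  where open ℚ.≤-Reasoning
nfGo-bound j L c (a ∷ as) 0≤L (0≤a ∷ 0≤as) with (L + a) ℚ.≤ᵇ 1ℚ in fits | suc c <ᵇ suc j in room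
... | true  | true  = begin
  toℚ (suc j) * toℚ (nfGo (suc j) (L + a) (suc (suc c)) as) ≤⟨ nfGo-bound j (L + a) (suc c) as 0≤L+a 0≤as ⟩
  potential j (L + a) (suc (suc c)) as                      ≤⟨ p≤p+q (0≤p*q (0≤toℚ j) 0≤a) ⟩
  potential j (L + a) (suc (suc c)) as + toℚ j * a          ≡⟨ potential-fit j L (suc c) a as ⟨
  potential j L (suc c) (a ∷ as)                            ∎
  where
  open ℚ.≤-Reasoning
  0≤L+a : 0ℚ ℚ.≤ L + a
  0≤L+a = ℚ.+-mono-≤ 0≤L 0≤a
... | true  | false = new-bin-bound j L c a as (nfGo (suc j) a 1 as) (ℚ.+-mono-≤ 0≤L 0≤a)
                        (inj₁ (ℕ.s≤s⁻¹ (<ᵇ≡false⇒≥ room))) (nfGo-bound j a 0 as 0≤a 0≤as)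
... | false | _     = new-bin-bound j L c a as (nfGo (suc j) a 1 as) (ℚ.+-mono-≤ 0≤L 0≤a)
                        (inj₂ (≤ᵇ≡false⇒> fits)) (nfGo-bound j a 0 as 0≤a 0≤as)

NF-bound : ∀ j I → All (0ℚ ℚ.≤_) I →
           toℚ (suc j) * toℚ (NF (suc j) I) ℚ.≤ toℚ (length I) + toℚ j * (sumℚ I + sumℚ I + 1ℚ)
NF-bound j [] [] = begin
  toℚ (suc j) * toℚ 0          ≡⟨ ℚ.*-zeroʳ (toℚ (suc j)) ⟩
  0ℚ                           ≤⟨ 0≤toℚ j ⟩
  toℚ j                        ≡⟨ identity (toℚ j) ⟩
  toℚ 0 + toℚ j * (0ℚ + 0ℚ + 1ℚ) ∎
  where
  open ℚ.≤-Reasoning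
  identity : ∀ J → J ≡ toℚ 0 + J * (0ℚ + 0ℚ + 1ℚ)
  identity = solve-∀ ℚ-ring
NF-bound j (a ∷ as) (0≤a ∷ 0≤as) = begin
  toℚ (suc j) * toℚ (nfGo (suc j) a 1 as) ≤⟨ nfGo-bound j a 0 as 0≤a 0≤as ⟩
  potential j a 1 as                      ≤⟨ p≤p+q (0≤p*q (0≤toℚ j) 0≤a) ⟩
  potential j a 1 as + toℚ j * a          ≡⟨ potential-start j a as ⟨
  toℚ (length (a ∷ as)) + toℚ j * (sumℚ (a ∷ as) + sumℚ (a ∷ as) + 1ℚ) ∎
  where open ℚ.≤-Reasoning

bound-scaling : ∀ {K} J M q → K ≡ 1ℚ + J → K * q ≡ + 2 / 1 →
                K * ((+ 3 / 1 - q) * M + 1ℚ) ≡ K * M + J * (M + M + 1ℚ) + 1ℚ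
bound-scaling J M q refl Kq≡2 = begin
  (1ℚ + J) * ((+ 3 / 1 - q) * M + 1ℚ)           ≡⟨ expand J M q ⟩
  X + (+ 2 / 1 - (1ℚ + J) * q) * M               ≡⟨ cong (λ t → X + (+ 2 / 1 - t) * M) Kq≡2 ⟩
  X + (+ 2 / 1 - + 2 / 1) * M                    ≡⟨ cancel X M ⟩
  X                                              ∎
  where
  open ≡-Reasoning
  X : ℚ
  X = (1ℚ + J) * M + J * (M + M + 1ℚ) + 1ℚ
  expand : ∀ J M q → (1ℚ + J) * ((+ 3 / 1 - q) * M + 1ℚ)
                   ≡ (1ℚ + J) * M + J * (M + M + 1ℚ) + 1ℚ + (+ 2 / 1 - (1ℚ + J) * q) * M
  expand = solve-∀ ℚ-ring
  cancel : ∀ X M → X + (+ 2 / 1 - + 2 / 1) * M ≡ X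
  cancel = solve-∀ ℚ-ring

-- The bound also holds for k = 1.
theorem13 : (k : ℕ) → .{{_ : NonZero k}} → 2 ≤ k →
    (I : List ℚ) → ValidInput I →
    (opt : ℕ) → IsOPT k I opt →
    toℚ (NF k I) ℚ.≤ ((+ 3 / 1) - (+ 2 / k)) * toℚ opt + 1ℚ
theorem13 (suc j) _ I valid _ ((f , feasible , refl) , _) =
  ℚ.*-cancelˡ-≤-pos k {{ℚ.normalize-pos (suc j) 1}} (begin
    k * toℚ (NF (suc j) I)                          ≤⟨ NF-bound j I (sizes-nonNeg valid) ⟩
    toℚ (length I) + toℚ j * (sumℚ I + sumℚ I + 1ℚ) ≤⟨ ℚ.+-mono-≤ (length-≤-usedBins (suc j) I f feasible)
                                                          (ℚ.*-monoˡ-≤-nonNeg (toℚ j) {{ℚ.normalize-nonNeg j 1}}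
                                                            (ℚ.+-monoˡ-≤ 1ℚ (ℚ.+-mono-≤ size≤M size≤M))) ⟩
    k * M + toℚ j * (M + M + 1ℚ)                    ≤⟨ p≤p+q (0≤toℚ 1) ⟩
    k * M + toℚ j * (M + M + 1ℚ) + 1ℚ               ≡⟨ bound-scaling (toℚ j) M (+ 2 / suc j) (toℚ-suc j) (toℚ-*-/ 2 j) ⟨
    k * ((+ 3 / 1 - + 2 / suc j) * M + 1ℚ)          ∎)
  where
  open ℚ.≤-Reasoning
  k : ℚ
  k = toℚ (suc j)
  M : ℚ
  M = toℚ (usedBins I f)
  size≤M : sumℚ I ℚ.≤ M
  size≤M = size-≤-usedBins (suc j) I f valid feasible
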